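{- Let $\Gamma$ be a finite connected simple graph with vertex degrees $n_i$, and let $\Sigma$ be a motif of $\Gamma$ with vertices $p_1,\dots,p_m$. Suppose a function $f$ on the vertices of $\Sigma$, not identically zero, and a real number $\lambda$ satisfy $$\frac{1}{n_i}\sum_{j\in\Sigma,\ j\sim i}f(j)=(1-\lambda)f(i)\quad\text{for all } i\in\Sigma,$$ where $n_i$ is the degree of $i$ in $\Gamma$. Let $\Gamma^\Sigma$ be obtained from $\Gamma$ by adding new vertices $q_1,\dots,q_m$, joining $q_\alpha$ and $q_\beta$ whenever $p_\alpha\sim p_\beta$, and joining each $q_\alpha$ to every vertex $p\notin\Sigma$ of $\Gamma$ adjacent to $p_\alpha$. Then $\lambda$ is an eigenvalue of the normalized Laplacian of $\Gamma^\Sigma$, with an eigenfunction equal to $f$ on $\Sigma$ (i.e. $f(p_\alpha)$ at $p_\alpha$), to $-f(p_\alpha)$ at $q_\alpha$, and to $0$ at all remaining vertices.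
   Context: A motif of $\Gamma$ is a connected subgraph containing all edges of $\Gamma$ between its vertices. For a finite graph without isolated vertices, with degrees $n_i$, the normalized Laplacian is $\Delta v(i)=v(i)-\frac{1}{n_i}\sum_{j\sim i}v(j)$; an eigenfunction for $\lambda$ is a nonzero $u$ with $\Delta u=\lambda u$, equivalently $\frac{1}{n_i}\sum_{j\sim i}u(j)=(1-\lambda)u(i)$ for all $i$. -}

module Defs where

open import Level using (Level)
open import Data.Nat using (ℕ; zero; suc; _<_) renaming (_+_ to _+ℕ_)
open import Data.Bool using (Bool; true; false; if_then_else_; not; _∧_)
open import Data.Fin using (Fin; splitAt; _↑ˡ_; _↑ʳ_)
open import Data.Fin.Properties using (any?) renaming (_≟_ to _≟F_)
open import Data.List using (List; foldr; map)
open import Data.Fin.Base using ()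
open import Data.List using ()
open import Data.Product using (Σ; ∃; _×_; _,_)
open import Data.Sum using (_⊎_; inj₁; inj₂)
open import Relation.Nullary using (¬_)
open import Relation.Nullary.Decidable using (⌊_⌋)
open import Relation.Binary.PropositionalEquality using (_≡_; refl)
open import Function.Definitions using (Injective)
open import Algebra.Bundles using (CommutativeRing)

allFin : (n : ℕ) → List (Fin n)
allFin n = Data.List.tabulate (λ i → i)

record Graph (n : ℕ) : Set where
  field
    adj    : Fin n → Fin n → Bool
    sym    : ∀ i j → adj i j ≡ adj j i
    irrefl : ∀ i → adj i i ≡ false
open Graph public

data Walk {n : ℕ} (G : Graph n) : Fin n → Fin n → Set where
  here : ∀ {i} → Walk G i i
  step : ∀ {i j k} → adj G i j ≡ true → Walk G j k → Walk G i k

Connected : {n : ℕ} → Graph n → Set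
Connected G = ∀ i j → Walk G i j

degree : {n : ℕ} → Graph n → Fin n → ℕ
degree {n} G i = foldr _+ℕ_ 0 (map (λ j → if adj G i j then 1 else 0) (allFin n))

NoIsolatedVertices : {n : ℕ} → Graph n → Set
NoIsolatedVertices G = ∀ i → 0 < degree G i

-- Motifs.  A vertex set of Γ is given by an injective enumeration
-- p : Fin m → Fin N (p α = p_α).  The motif is the induced subgraph on it,
-- which must be connected.

induced : {N m : ℕ} → Graph N → (Fin m → Fin N) → Graph m
induced G p = record
  { adj    = λ α β → adj G (p α) (p β)
  ; sym    = λ α β → sym G (p α) (p β)
  ; irrefl = λ α → irrefl G (p α) }

IsMotif : {N m : ℕ} → Graph N → (Fin m → Fin N) → Set
IsMotif G p = Injective _≡_ _≡_ p × Connected (induced G p)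

InΣ : {N m : ℕ} → (Fin m → Fin N) → Fin N → Set
InΣ {m = m} p v = ∃ λ (α : Fin m) → p α ≡ v

inΣ? : {N m : ℕ} → (Fin m → Fin N) → Fin N → Bool
inΣ? p v = ⌊ any? (λ α → p α ≟F v) ⌋

-- The graph Γ^Σ on Fin (N +ℕ m): old vertex v is  v ↑ˡ m,
-- new vertex q_α is  N ↑ʳ α.

module _ {N m : ℕ} (G : Graph N) (p : Fin m → Fin N) where

  adjS : Fin N ⊎ Fin m → Fin N ⊎ Fin m → Bool
  adjS (inj₁ u) (inj₁ v) = adj G u v
  adjS (inj₂ α) (inj₂ β) = adj G (p α) (p β)
  adjS (inj₂ α) (inj₁ v) = not (inΣ? p v) ∧ adj G (p α) v
  adjS (inj₁ v) (inj₂ α) = not (inΣ? p v) ∧ adj G (p α) v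

  adjS-sym : ∀ x y → adjS x y ≡ adjS y x
  adjS-sym (inj₁ u) (inj₁ v) = sym G u v
  adjS-sym (inj₂ α) (inj₂ β) = sym G (p α) (p β)
  adjS-sym (inj₂ α) (inj₁ v) = refl
  adjS-sym (inj₁ v) (inj₂ α) = refl

  adjS-irrefl : ∀ x → adjS x x ≡ false
  adjS-irrefl (inj₁ u) = irrefl G u
  adjS-irrefl (inj₂ α) = irrefl G (p α)

  extend : Graph (N +ℕ m)
  extend = record
    { adj    = λ x y → adjS (splitAt N x) (splitAt N y)
    ; sym    = λ x y → adjS-sym (splitAt N x) (splitAt N y)
    ; irrefl = λ x → adjS-irrefl (splitAt N x) }

  oldV : Fin N → Fin (N +ℕ m)
  oldV v = v ↑ˡ m

  newV : Fin m → Fin (N +ℕ m)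
  newV α = N ↑ʳ α

-- Functions with values in a commutative ring R (standing for ℝ);
-- `inv k` plays the role of 1/k for positive integers k.

module WithRing {c ℓ : Level} (R : CommutativeRing c ℓ) where
  open CommutativeRing R

  ι : ℕ → Carrier
  ι zero    = 0#
  ι (suc k) = 1# + ι k

  InvertsPositiveIntegers : (ℕ → Carrier) → Set ℓ
  InvertsPositiveIntegers inv = ∀ k → ι (suc k) * inv (suc k) ≈ 1#

  sumFin : {n : ℕ} → (Fin n → Carrier) → Carrier
  sumFin {n} u = foldr _+_ 0# (map u (allFin n))

  nbrSum : {n : ℕ} → Graph n → (Fin n → Carrier) → Fin n → Carrier
  nbrSum G u i = sumFin (λ j → if adj G i j then u j else 0#)

  Δ : {n : ℕ} → (ℕ → Carrier) → Graph n → (Fin n → Carrier) → Fin n → Carrier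
  Δ inv G u i = u i - inv (degree G i) * nbrSum G u i

  IsEigenfunction : {n : ℕ} → (ℕ → Carrier) → Graph n → Carrier → (Fin n → Carrier) → Set ℓ
  IsEigenfunction inv G lam u = (¬ (∀ i → u i ≈ 0#)) × (∀ i → Δ inv G u i ≈ lam * u i)

module Submission where

-- Put g = f on Σ, g = −f on the copies q_α, and g = 0 elsewhere. A copy q_α has exactly as many
-- neighbours as p_α (its neighbours inside the copy of Σ plus those of p_α outside Σ), sees only
-- −f among them, and so satisfies the same mean-value equation as p_α with the sign flipped. A
-- vertex p_α of Σ is adjacent to no copy and sees exactly the equation for f. A vertex v outside
-- Σ sees f(p_α) and −f(q_α) for every p_α ∼ v, which cancel, matching g(v) = 0.

open import Defs
open import Level using (Level)
open import Data.Nat using (ℕ; zero; suc) renaming (_+_ to _+ℕ_)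
open import Data.Nat.Properties using (+-0-commutativeMonoid)
open import Data.Bool using (Bool; true; false; if_then_else_; not; _∧_)
open import Data.Fin using (Fin; zero; suc; splitAt; _↑ˡ_; _↑ʳ_)
open import Data.Fin.Properties using (_≟_; any?; splitAt-↑ˡ; splitAt-↑ʳ; join-splitAt)
open import Data.List using (foldr; map; tabulate)
open import Data.List.Properties using (map-tabulate)
open import Data.Vec.Functional using (_++_)
open import Data.Vec.Functional.Properties using (lookup-++ˡ; lookup-++ʳ)
open import Data.Product using (Σ; _×_; _,_)
open import Data.Sum using (_⊎_; inj₁; inj₂)
open import Data.Empty using (⊥-elim)
open import Function using (_∘_)
open import Function.Definitions using (Injective)
open import Relation.Nullary using (¬_; yes; no)
open import Relation.Nullary.Decidable using (⌊_⌋)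
open import Relation.Binary.PropositionalEquality as ≡ using (_≡_; refl; cong)
open import Algebra.Bundles using (CommutativeMonoid; CommutativeRing)

module _ {N m : ℕ} (p : Fin m → Fin N) where

  data ImageView : Fin N → Set where
    image   : ∀ γ → ImageView (p γ)
    outside : ∀ {u} → ¬ InΣ p u → ImageView u

  imageView : ∀ u → ImageView u
  imageView u with any? (λ α → p α ≟ u)
  ... | yes (γ , refl) = image γ
  ... | no u∉Σ         = outside u∉Σ

  inΣ?-image : ∀ γ → inΣ? p (p γ) ≡ true
  inΣ?-image γ with any? (λ α → p α ≟ p γ)
  ... | yes _   = refl
  ... | no γ∉Σ  = ⊥-elim (γ∉Σ (γ , refl))

  inΣ?-outside : ∀ {u} → ¬ InΣ p u → inΣ? p u ≡ false
  inΣ?-outside {u} u∉Σ with any? (λ α → p α ≟ u)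
  ... | yes u∈Σ = ⊥-elim (u∉Σ u∈Σ)
  ... | no _    = refl

  ≟-outside : ∀ {u} → ¬ InΣ p u → ∀ β → ⌊ p β ≟ u ⌋ ≡ false
  ≟-outside {u} u∉Σ β with p β ≟ u
  ... | yes pβ≡u = ⊥-elim (u∉Σ (β , pβ≡u))
  ... | no _     = refl

  ≟-injective : Injective _≡_ _≡_ p → ∀ β γ → ⌊ p β ≟ p γ ⌋ ≡ ⌊ γ ≟ β ⌋
  ≟-injective injective β γ with p β ≟ p γ | γ ≟ β
  ... | yes _       | yes _   = refl
  ... | no _        | no _    = refl
  ... | yes pβ≡pγ   | no γ≢β  = ⊥-elim (γ≢β (≡.sym (injective pβ≡pγ)))
  ... | no pβ≢pγ    | yes γ≡β = ⊥-elim (pβ≢pγ (cong p (≡.sym γ≡β)))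

data Side {N m : ℕ} : Fin (N +ℕ m) → Set where
  old : ∀ v → Side (v ↑ˡ m)
  new : ∀ α → Side (N ↑ʳ α)

side : ∀ N m x → Side {N} {m} x
side N m x with splitAt N x | join-splitAt N m x
... | inj₁ v | refl = old v
... | inj₂ α | refl = new α

module Sums {c ℓ : Level} (M : CommutativeMonoid c ℓ) where
  open CommutativeMonoid M renaming (refl to ≈-refl; sym to ≈-sym)
  open import Algebra.Properties.CommutativeMonoid.Sum M public
    using (sum; sum-cong-≋; sum-replicate-zero; ∑-comm; ∑-distrib-+)
  open import Relation.Binary.Reasoning.Setoid setoid

  foldr-tabulate : ∀ {n} (h : Fin n → Carrier) → foldr _∙_ ε (tabulate h) ≡ sum h
  foldr-tabulate {zero}  h = refl
  foldr-tabulate {suc n} h = cong (h zero ∙_) (foldr-tabulate (h ∘ suc))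

  foldr-allFin : ∀ {n} (h : Fin n → Carrier) → foldr _∙_ ε (map h (allFin n)) ≡ sum h
  foldr-allFin {n} h = ≡.trans (cong (foldr _∙_ ε) (map-tabulate (λ i → i) h)) (foldr-tabulate h)

  sum-zero : ∀ {n} (h : Fin n → Carrier) → (∀ i → h i ≈ ε) → sum h ≈ ε
  sum-zero {n} h h≈ε = trans (sum-cong-≋ h≈ε) (sum-replicate-zero n)

  sum-splitAt : ∀ N {m} (h : Fin (N +ℕ m) → Carrier) →
                sum h ≈ sum (h ∘ (_↑ˡ m)) ∙ sum (h ∘ (N ↑ʳ_))
  sum-splitAt zero    h = ≈-sym (identityˡ _)
  sum-splitAt (suc N) h = trans (∙-congˡ (sum-splitAt N (h ∘ suc))) (≈-sym (assoc _ _ _))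

  select-sum : ∀ {n} b (h : Fin n → Carrier) →
               (if b then sum h else ε) ≈ sum (λ i → if b then h i else ε)
  select-sum true  h = ≈-refl
  select-sum false h = ≈-sym (sum-zero (λ i → if false then h i else ε) (λ _ → ≈-refl))

  select-cong : ∀ b {x y} → x ≈ y → (if b then x else ε) ≈ (if b then y else ε)
  select-cong true  x≈y = x≈y
  select-cong false _   = ≈-refl

  select-zero : ∀ b {x} → x ≈ ε → (if b then x else ε) ≈ ε
  select-zero true  x≈ε = x≈ε
  select-zero false _   = ≈-refl

  select-swap : ∀ b b′ x → (if b then (if b′ then x else ε) else ε) ≡ (if b′ then (if b then x else ε) else ε)
  select-swap true  true  x = refl
  select-swap true  false x = refl
  select-swap false true  x = refl
  select-swap false false x = refl

  sum-indicator : ∀ {n} (i : Fin n) (h : Fin n → Carrier) →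
                  sum (λ j → if ⌊ i ≟ j ⌋ then h j else ε) ≈ h i
  sum-indicator zero    h =
    trans (∙-congˡ (sum-zero (λ j → if ⌊ zero ≟ suc j ⌋ then h (suc j) else ε) (λ _ → ≈-refl)))
          (identityʳ (h zero))
  sum-indicator (suc i) h = trans (identityˡ _) (trans (sum-cong-≋ shift) (sum-indicator i (h ∘ suc)))
    where
    shift : ∀ j → (if ⌊ suc i ≟ suc j ⌋ then h (suc j) else ε) ≈ (if ⌊ i ≟ j ⌋ then h (suc j) else ε)
    shift j with i ≟ j
    ... | yes _ = ≈-refl
    ... | no  _ = ≈-refl

  module _ {N m : ℕ} (p : Fin m → Fin N) where

    -- For injective p this is f transported onto the image of p, and ε off it.
    push : (Fin m → Carrier) → Fin N → Carrier
    push f u = sum (λ β → if ⌊ p β ≟ u ⌋ then f β else ε)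

    sum-select-push : ∀ (c : Fin N → Bool) f →
                      sum (λ u → if c u then push f u else ε) ≈ sum (λ β → if c (p β) then f β else ε)
    sum-select-push c f = begin
      sum (λ u → if c u then push f u else ε)
        ≈⟨ sum-cong-≋ (λ u → select-sum (c u) (λ β → if ⌊ p β ≟ u ⌋ then f β else ε)) ⟩
      sum (λ u → sum (λ β → if c u then (if ⌊ p β ≟ u ⌋ then f β else ε) else ε))
        ≈⟨ ∑-comm (λ u β → if c u then (if ⌊ p β ≟ u ⌋ then f β else ε) else ε) ⟩
      sum (λ β → sum (λ u → if c u then (if ⌊ p β ≟ u ⌋ then f β else ε) else ε))
        ≈⟨ sum-cong-≋ (λ β → trans (sum-cong-≋ (λ u → reflexive (select-swap (c u) _ (f β))))
                                   (sum-indicator (p β) (λ u → if c u then f β else ε))) ⟩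
      sum (λ β → if c (p β) then f β else ε) ∎

    push-outside : ∀ {u} → ¬ InΣ p u → ∀ f → push f u ≈ ε
    push-outside {u} u∉Σ f =
      sum-zero (λ β → if ⌊ p β ≟ u ⌋ then f β else ε)
               (λ β → reflexive (cong (λ b → if b then f β else ε) (≟-outside p u∉Σ β)))

    push-image : Injective _≡_ _≡_ p → ∀ f γ → push f (p γ) ≈ f γ
    push-image injective f γ =
      trans (sum-cong-≋ (λ β → reflexive (cong (λ b → if b then f β else ε) (≟-injective p injective β γ))))
            (sum-indicator γ f)

    push-restrict : Injective _≡_ _≡_ p → ∀ (h : Fin N → Carrier) u →
                    push (h ∘ p) u ≈ (if inΣ? p u then h u else ε)
    push-restrict injective h u with imageView p u
    ... | image γ     rewrite inΣ?-image p γ     = push-image injective (h ∘ p) γ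
    ... | outside u∉Σ rewrite inΣ?-outside p u∉Σ = push-outside u∉Σ (h ∘ p)

    sum-outside-image : Injective _≡_ _≡_ p → ∀ (c : Fin N → Bool) (h : Fin N → Carrier) →
      sum (λ u → if not (inΣ? p u) ∧ c u then h u else ε) ∙ sum (λ β → if c (p β) then h (p β) else ε)
        ≈ sum (λ u → if c u then h u else ε)
    sum-outside-image injective c h = begin
      sum (λ u → if not (inΣ? p u) ∧ c u then h u else ε) ∙ sum (λ β → if c (p β) then h (p β) else ε)
        ≈⟨ ∙-congˡ (≈-sym (sum-select-push c (h ∘ p))) ⟩
      sum (λ u → if not (inΣ? p u) ∧ c u then h u else ε) ∙ sum (λ u → if c u then push (h ∘ p) u else ε)
        ≈⟨ ≈-sym (∑-distrib-+ (λ u → if not (inΣ? p u) ∧ c u then h u else ε)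
                              (λ u → if c u then push (h ∘ p) u else ε)) ⟩
      sum (λ u → (if not (inΣ? p u) ∧ c u then h u else ε) ∙ (if c u then push (h ∘ p) u else ε))
        ≈⟨ sum-cong-≋ (λ u → trans (∙-congˡ (select-cong (c u) (push-restrict injective h u)))
                                   (select-split (inΣ? p u) (c u) (h u))) ⟩
      sum (λ u → if c u then h u else ε) ∎
      where
      select-split : ∀ b b′ x → (if not b ∧ b′ then x else ε) ∙ (if b′ then (if b then x else ε) else ε)
                                ≈ (if b′ then x else ε)
      select-split true  true  x = identityˡ x
      select-split false true  x = identityʳ x
      select-split true  false x = identityˡ ε
      select-split false false x = identityˡ ε

  neighbourSum : ∀ {n} → Graph n → (Fin n → Carrier) → Fin n → Carrier
  neighbourSum G h i = sum (λ j → if adj G i j then h j else ε)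

  module _ {N m : ℕ} (Γ : Graph N) (p : Fin m → Fin N) (h : Fin (N +ℕ m) → Carrier) where

    private
      oldPart newPart : Fin N ⊎ Fin m → Carrier
      oldPart s = sum (λ u → if adjS Γ p s (inj₁ u) then h (oldV Γ p u) else ε)
      newPart s = sum (λ β → if adjS Γ p s (inj₂ β) then h (newV Γ p β) else ε)

    neighbourSum-extend : ∀ x → neighbourSum (extend Γ p) h x ≈ oldPart (splitAt N x) ∙ newPart (splitAt N x)
    neighbourSum-extend x = trans (sum-splitAt N _) (∙-cong
      (sum-cong-≋ (λ u → reflexive (cong (λ s → if adjS Γ p (splitAt N x) s then h (u ↑ˡ m) else ε)
                                         (splitAt-↑ˡ N u m))))
      (sum-cong-≋ (λ β → reflexive (cong (λ s → if adjS Γ p (splitAt N x) s then h (N ↑ʳ β) else ε)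
                                         (splitAt-↑ʳ N m β)))))

    neighbourSum-new : ∀ α → neighbourSum (extend Γ p) h (newV Γ p α)
      ≈ sum (λ u → if not (inΣ? p u) ∧ adj Γ (p α) u then h (oldV Γ p u) else ε)
        ∙ sum (λ β → if adj Γ (p α) (p β) then h (newV Γ p β) else ε)
    neighbourSum-new α = trans (neighbourSum-extend (newV Γ p α))
                               (reflexive (cong (λ s → oldPart s ∙ newPart s) (splitAt-↑ʳ N m α)))

    neighbourSum-old : ∀ v → neighbourSum (extend Γ p) h (oldV Γ p v)
      ≈ neighbourSum Γ (h ∘ oldV Γ p) v ∙ sum (λ β → if not (inΣ? p v) ∧ adj Γ (p β) v then h (newV Γ p β) else ε)
    neighbourSum-old v = trans (neighbourSum-extend (oldV Γ p v))
                               (reflexive (cong (λ s → oldPart s ∙ newPart s) (splitAt-↑ˡ N v m)))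

    neighbourSum-image : ∀ γ → neighbourSum (extend Γ p) h (oldV Γ p (p γ)) ≈ neighbourSum Γ (h ∘ oldV Γ p) (p γ)
    neighbourSum-image γ =
      trans (neighbourSum-old (p γ)) (trans (∙-congˡ (sum-zero _ noNewNeighbour)) (identityʳ _))
      where
      noNewNeighbour : ∀ β → (if not (inΣ? p (p γ)) ∧ adj Γ (p β) (p γ) then h (newV Γ p β) else ε) ≈ ε
      noNewNeighbour β rewrite inΣ?-image p γ = ≈-refl

module _ where
  open Sums +-0-commutativeMonoid

  degree-neighbourSum : ∀ {n} (G : Graph n) i → degree G i ≡ neighbourSum G (λ _ → 1) i
  degree-neighbourSum G i = foldr-allFin (λ j → if adj G i j then 1 else 0)

  degree-new : ∀ {N m} (Γ : Graph N) (p : Fin m → Fin N) → Injective _≡_ _≡_ p →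
               ∀ α → degree (extend Γ p) (newV Γ p α) ≡ degree Γ (p α)
  degree-new Γ p injective α = ≡.trans (degree-neighbourSum (extend Γ p) (newV Γ p α))
    (≡.trans (neighbourSum-new Γ p (λ _ → 1) α)
    (≡.trans (sum-outside-image p injective (adj Γ (p α)) (λ _ → 1))
             (≡.sym (degree-neighbourSum Γ (p α)))))

  degree-image : ∀ {N m} (Γ : Graph N) (p : Fin m → Fin N) γ →
                 degree (extend Γ p) (oldV Γ p (p γ)) ≡ degree Γ (p γ)
  degree-image Γ p γ = ≡.trans (degree-neighbourSum (extend Γ p) (oldV Γ p (p γ)))
    (≡.trans (neighbourSum-image Γ p (λ _ → 1) γ) (≡.sym (degree-neighbourSum Γ (p γ))))

module RingFacts {c ℓ : Level} (R : CommutativeRing c ℓ) where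
  open CommutativeRing R hiding (zero) renaming (refl to ≈-refl; sym to ≈-sym)
  open Sums +-commutativeMonoid using (sum)
  open import Algebra.Properties.Ring ring using (-0#≈0#; -‿+-comm; [y-z]x≈yx-zx; ⁻¹-anti-homo‿-; xyx⁻¹≈y)
  open import Relation.Binary.Reasoning.Setoid setoid

  mean⇒eigen : ∀ {x y l} → y ≈ (1# - l) * x → x - y ≈ l * x
  mean⇒eigen {x} {y} {l} y≈[1-l]x = begin
    x - y                ≈⟨ +-congˡ (-‿cong (trans y≈[1-l]x ([y-z]x≈yx-zx x 1# l))) ⟩
    x - (1# * x - l * x) ≈⟨ +-congˡ (-‿cong (+-congʳ (*-identityˡ x))) ⟩
    x - (x - l * x)      ≈⟨ +-congˡ (⁻¹-anti-homo‿- x (l * x)) ⟩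
    x + (l * x - x)      ≈⟨ ≈-sym (+-assoc x (l * x) (- x)) ⟩
    x + l * x - x        ≈⟨ xyx⁻¹≈y x (l * x) ⟩
    l * x                ∎

  sum-neg : ∀ {n} (h : Fin n → Carrier) → sum (λ i → - h i) ≈ - sum h
  sum-neg {zero}  h = ≈-sym -0#≈0#
  sum-neg {suc n} h = trans (+-congˡ (sum-neg (h ∘ suc))) (-‿+-comm (h zero) (sum (h ∘ suc)))

  select-neg : ∀ b x → (if b then - x else 0#) ≈ - (if b then x else 0#)
  select-neg true  x = ≈-refl
  select-neg false x = ≈-sym -0#≈0#

module _ {c ℓ : Level} (R : CommutativeRing c ℓ) where
  open CommutativeRing R hiding (zero) renaming (refl to ≈-refl; sym to ≈-sym)
  open WithRing R
  open Sums +-commutativeMonoid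
  open RingFacts R
  open import Algebra.Properties.Ring ring using (-‿distribʳ-*)
  open import Relation.Binary.Reasoning.Setoid setoid

  nbrSum≡neighbourSum : ∀ {n} (G : Graph n) u i → nbrSum G u i ≡ neighbourSum G u i
  nbrSum≡neighbourSum G u i = foldr-allFin (λ j → if adj G i j then u j else 0#)

  module Eigenfunction (inv : ℕ → Carrier) {N m : ℕ} (Γ : Graph N) (p : Fin m → Fin N)
    (injective : Injective _≡_ _≡_ p) (f : Fin m → Carrier) (lam : Carrier)
    (mean-f : ∀ α → inv (degree Γ (p α)) * sumFin (λ β → if adj Γ (p α) (p β) then f β else 0#)
                    ≈ (1# - lam) * f α) where

    g : Fin (N +ℕ m) → Carrier
    g = push p f ++ (-_ ∘ f)

    g-old : ∀ v → g (oldV Γ p v) ≡ push p f v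
    g-old v = lookup-++ˡ (push p f) (-_ ∘ f) v

    g-image : ∀ α → g (oldV Γ p (p α)) ≈ f α
    g-image α = trans (reflexive (g-old (p α))) (push-image p injective f α)

    g-new : ∀ α → g (newV Γ p α) ≈ - f α
    g-new α = reflexive (lookup-++ʳ (push p f) (-_ ∘ f) α)

    g-outside : ∀ v → ¬ InΣ p v → g (oldV Γ p v) ≈ 0#
    g-outside v v∉Σ = trans (reflexive (g-old v)) (push-outside p v∉Σ f)

    g-nonzero : ¬ (∀ α → f α ≈ 0#) → ¬ (∀ x → g x ≈ 0#)
    g-nonzero f≢0 g≈0 = f≢0 (λ α → trans (≈-sym (g-image α)) (g≈0 (oldV Γ p (p α))))

    mean-f′ : ∀ α → inv (degree Γ (p α)) * neighbourSum (induced Γ p) f α ≈ (1# - lam) * f α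
    mean-f′ α = trans (*-congˡ (reflexive (≡.sym (nbrSum≡neighbourSum (induced Γ p) f α)))) (mean-f α)

    neighbourSum-g-old : ∀ v → neighbourSum Γ (g ∘ oldV Γ p) v ≈ sum (λ β → if adj Γ v (p β) then f β else 0#)
    neighbourSum-g-old v =
      trans (sum-cong-≋ (λ u → reflexive (cong (λ x → if adj Γ v u then x else 0#) (g-old u))))
            (sum-select-push p (adj Γ v) f)

    nbrSum-new : ∀ α → nbrSum (extend Γ p) g (newV Γ p α) ≈ - neighbourSum (induced Γ p) f α
    nbrSum-new α = begin
      nbrSum (extend Γ p) g (newV Γ p α)
        ≡⟨ nbrSum≡neighbourSum (extend Γ p) g (newV Γ p α) ⟩
      neighbourSum (extend Γ p) g (newV Γ p α)
        ≈⟨ neighbourSum-new Γ p g α ⟩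
      sum (λ u → if not (inΣ? p u) ∧ adj Γ (p α) u then g (oldV Γ p u) else 0#)
        + sum (λ β → if adj Γ (p α) (p β) then g (newV Γ p β) else 0#)
        ≈⟨ +-cong (sum-zero _ oldNeighbour)
                  (trans (sum-cong-≋ newNeighbour) (sum-neg (λ β → if adj Γ (p α) (p β) then f β else 0#))) ⟩
      0# + - neighbourSum (induced Γ p) f α
        ≈⟨ +-identityˡ _ ⟩
      - neighbourSum (induced Γ p) f α ∎
      where
      oldNeighbour : ∀ u → (if not (inΣ? p u) ∧ adj Γ (p α) u then g (oldV Γ p u) else 0#) ≈ 0#
      oldNeighbour u with imageView p u
      ... | image γ rewrite inΣ?-image p γ = ≈-refl
      ... | outside u∉Σ = select-zero _ (g-outside u u∉Σ)

      newNeighbour : ∀ β → (if adj Γ (p α) (p β) then g (newV Γ p β) else 0#)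
                           ≈ - (if adj Γ (p α) (p β) then f β else 0#)
      newNeighbour β = trans (select-cong _ (g-new β)) (select-neg _ (f β))

    nbrSum-image : ∀ γ → nbrSum (extend Γ p) g (oldV Γ p (p γ)) ≈ neighbourSum (induced Γ p) f γ
    nbrSum-image γ = begin
      nbrSum (extend Γ p) g (oldV Γ p (p γ))
        ≡⟨ nbrSum≡neighbourSum (extend Γ p) g (oldV Γ p (p γ)) ⟩
      neighbourSum (extend Γ p) g (oldV Γ p (p γ))
        ≈⟨ neighbourSum-image Γ p g γ ⟩
      neighbourSum Γ (g ∘ oldV Γ p) (p γ)
        ≈⟨ neighbourSum-g-old (p γ) ⟩
      neighbourSum (induced Γ p) f γ ∎

    nbrSum-outside : ∀ {v} → ¬ InΣ p v → nbrSum (extend Γ p) g (oldV Γ p v) ≈ 0#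
    nbrSum-outside {v} v∉Σ = begin
      nbrSum (extend Γ p) g (oldV Γ p v)
        ≡⟨ nbrSum≡neighbourSum (extend Γ p) g (oldV Γ p v) ⟩
      neighbourSum (extend Γ p) g (oldV Γ p v)
        ≈⟨ neighbourSum-old Γ p g v ⟩
      neighbourSum Γ (g ∘ oldV Γ p) v
        + sum (λ β → if not (inΣ? p v) ∧ adj Γ (p β) v then g (newV Γ p β) else 0#)
        ≈⟨ +-cong (neighbourSum-g-old v) newNeighbours ⟩
      fromΣ - fromΣ
        ≈⟨ -‿inverseʳ fromΣ ⟩
      0# ∎
      where
      fromΣ : Carrier
      fromΣ = sum (λ β → if adj Γ v (p β) then f β else 0#)

      newNeighbours : sum (λ β → if not (inΣ? p v) ∧ adj Γ (p β) v then g (newV Γ p β) else 0#) ≈ - fromΣ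
      newNeighbours rewrite inΣ?-outside p v∉Σ =
        trans (sum-cong-≋ newNeighbour) (sum-neg (λ β → if adj Γ v (p β) then f β else 0#))
        where
        newNeighbour : ∀ β → (if adj Γ (p β) v then g (newV Γ p β) else 0#)
                             ≈ - (if adj Γ v (p β) then f β else 0#)
        newNeighbour β rewrite sym Γ (p β) v = trans (select-cong _ (g-new β)) (select-neg _ (f β))

    mean-new : ∀ α → inv (degree (extend Γ p) (newV Γ p α)) * nbrSum (extend Γ p) g (newV Γ p α)
                     ≈ (1# - lam) * g (newV Γ p α)
    mean-new α = begin
      inv (degree (extend Γ p) (newV Γ p α)) * nbrSum (extend Γ p) g (newV Γ p α)
        ≈⟨ *-cong (reflexive (cong inv (degree-new Γ p injective α))) (nbrSum-new α) ⟩
      inv (degree Γ (p α)) * - neighbourSum (induced Γ p) f α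
        ≈⟨ ≈-sym (-‿distribʳ-* _ _) ⟩
      - (inv (degree Γ (p α)) * neighbourSum (induced Γ p) f α)
        ≈⟨ -‿cong (mean-f′ α) ⟩
      - ((1# - lam) * f α)
        ≈⟨ -‿distribʳ-* _ _ ⟩
      (1# - lam) * - f α
        ≈⟨ *-congˡ (≈-sym (g-new α)) ⟩
      (1# - lam) * g (newV Γ p α) ∎

    mean-image : ∀ γ → inv (degree (extend Γ p) (oldV Γ p (p γ))) * nbrSum (extend Γ p) g (oldV Γ p (p γ))
                       ≈ (1# - lam) * g (oldV Γ p (p γ))
    mean-image γ = begin
      inv (degree (extend Γ p) (oldV Γ p (p γ))) * nbrSum (extend Γ p) g (oldV Γ p (p γ))
        ≈⟨ *-cong (reflexive (cong inv (degree-image Γ p γ))) (nbrSum-image γ) ⟩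
      inv (degree Γ (p γ)) * neighbourSum (induced Γ p) f γ
        ≈⟨ mean-f′ γ ⟩
      (1# - lam) * f γ
        ≈⟨ *-congˡ (≈-sym (g-image γ)) ⟩
      (1# - lam) * g (oldV Γ p (p γ)) ∎

    mean-outside : ∀ {v} → ¬ InΣ p v →
                   inv (degree (extend Γ p) (oldV Γ p v)) * nbrSum (extend Γ p) g (oldV Γ p v)
                   ≈ (1# - lam) * g (oldV Γ p v)
    mean-outside {v} v∉Σ = begin
      inv (degree (extend Γ p) (oldV Γ p v)) * nbrSum (extend Γ p) g (oldV Γ p v)
        ≈⟨ *-congˡ (nbrSum-outside v∉Σ) ⟩
      inv (degree (extend Γ p) (oldV Γ p v)) * 0#
        ≈⟨ zeroʳ _ ⟩
      0#
        ≈⟨ ≈-sym (zeroʳ _) ⟩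
      (1# - lam) * 0#
        ≈⟨ *-congˡ (≈-sym (g-outside v v∉Σ)) ⟩
      (1# - lam) * g (oldV Γ p v) ∎

    mean : ∀ x → inv (degree (extend Γ p) x) * nbrSum (extend Γ p) g x ≈ (1# - lam) * g x
    mean x with side N m x
    ... | new α = mean-new α
    ... | old v with imageView p v
    ...   | image γ     = mean-image γ
    ...   | outside v∉Σ = mean-outside v∉Σ

    g-eigen : ∀ x → Δ inv (extend Γ p) g x ≈ lam * g x
    g-eigen x = mean⇒eigen (mean x)

mainTheorem4 : {c ℓ : Level} (R : CommutativeRing c ℓ) →
  let open CommutativeRing R in let open WithRing R in
  (inv : ℕ → Carrier) → InvertsPositiveIntegers inv →
  {N m : ℕ} (Γ : Graph N) → Connected Γ → NoIsolatedVertices Γ →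
  (p : Fin m → Fin N) → IsMotif Γ p →
  (f : Fin m → Carrier) (lam : Carrier) → ¬ (∀ α → f α ≈ 0#) →
  (∀ α → inv (degree Γ (p α)) * sumFin (λ β → if adj Γ (p α) (p β) then f β else 0#)
           ≈ (1# - lam) * f α) →
  Σ (Fin (N +ℕ m) → Carrier) λ g →
    IsEigenfunction inv (extend Γ p) lam g
    × (∀ α → g (oldV Γ p (p α)) ≈ f α)
    × (∀ α → g (newV Γ p α) ≈ - f α)
    × (∀ v → ¬ InΣ p v → g (oldV Γ p v) ≈ 0#)
mainTheorem4 R inv _ Γ _ _ p (injective , _) f lam f≢0 mean-f =
  g , (g-nonzero f≢0 , g-eigen) , g-image , g-new , g-outside
  where open Eigenfunction R inv Γ p injective f lam mean-f
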